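{- Let $f:\{0,1\}^n\to\{0,1\}$ be given by a compact form DNF representation of size $d_\vee$ and width $d_\wedge$ with the block property. Then $\mathrm{s}(f)\ge\left\lceil\frac{d_\vee}{2d_\wedge-1}\right\rceil$.
   Context: For $x\in\{0,1\}^n$, $x^i$ flips bit $i$ and $x^B$ flips bits in $B\subseteq[n]$. $\mathrm{s}(f,x)=|\{i: f(x)\neq f(x^i)\}|$, $\mathrm{s}(f)=\max_x\mathrm{s}(f,x)$. $\mathrm{bs}(f,x)$ is the maximum number of pairwise disjoint $B\subseteq[n]$ with $f(x^B)\ne f(x)$; $\mathrm{bs}_0(f)=\max_{f(x)=0}\mathrm{bs}(f,x)$. A DNF representation is an OR of $d_\vee$ terms $\wedge_1,\dots,\wedge_{d_\vee}$ (size $d_\vee$), each an AND of literals, no term containing a variable and its negation; $A_i$ (resp. $\overline{A}_i$) is the set of variables unnegated (resp. negated) in $\wedge_i$; width $d_\wedge=\max_i(|A_i|+|\overline{A}_i|)$; $S_i$ is the set of assignments satisfying $\wedge_i$. Compact form: (a) $f(0^n)=0$, (b) $\mathrm{bs}_0(f)=\mathrm{bs}(f,0^n)$, (c) $S_i\setminus\bigcup_{j\ne i}S_j\ne\emptyset$ for all $i$. Block property: $A_i\cap A_j=\emptyset$ for $i\neq j$. -}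

module Defs where

open import Data.Nat using (ℕ; zero; suc; _+_; _*_; _∸_; _⊔_; _≤_; NonZero)
open import Data.Nat.DivMod using (_/_)
open import Data.Bool using (Bool; true; false; not; _∧_; _∨_; _xor_; if_then_else_)
open import Data.Fin using (Fin)
open import Data.Fin.Subset using (Subset; _∩_; Empty; ∣_∣)
open import Data.Vec using (Vec; []; _∷_; lookup; zipWith; replicate; updateAt)
open import Data.List using (List; []; _∷_; map; foldr; concatMap; allFin)
open import Data.Nat.ListAction using (sum)
open import Data.Bool.ListAction using (and; or)
open import Data.Product using (Σ; ∃; _×_; _,_)
open import Relation.Binary.PropositionalEquality using (_≡_; _≢_)

-- Inputs x ∈ {0,1}^n (false = 0, true = 1)
Input : ℕ → Set
Input n = Vec Bool n

BoolFun : ℕ → Set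
BoolFun n = Input n → Bool

allInputs : (n : ℕ) → List (Input n)
allInputs zero = [] ∷ []
allInputs (suc n) = concatMap (λ v → (false ∷ v) ∷ (true ∷ v) ∷ []) (allInputs n)

zeroInput : (n : ℕ) → Input n
zeroInput n = replicate n false

flipBit : {n : ℕ} → Fin n → Input n → Input n
flipBit i x = updateAt x i not

flipBlock : {n : ℕ} → Subset n → Input n → Input n
flipBlock B x = zipWith _xor_ x B

sensAt : {n : ℕ} → BoolFun n → Input n → ℕ
sensAt {n} f x = sum (map (λ i → if f x xor f (flipBit i x) then 1 else 0) (allFin n))

sens : {n : ℕ} → BoolFun n → ℕ
sens {n} f = foldr _⊔_ 0 (map (sensAt f) (allInputs n))

SensBlocks : {n : ℕ} → BoolFun n → Input n → ℕ → Set
SensBlocks {n} f x k =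
  Σ (Fin k → Subset n) λ B →
    (∀ a → f (flipBlock (B a) x) ≢ f x) ×
    (∀ a b → a ≢ b → Empty (B a ∩ B b))

IsBsAt : {n : ℕ} → BoolFun n → Input n → ℕ → Set
IsBsAt f x k = SensBlocks f x k × (∀ m → SensBlocks f x m → m ≤ k)

IsBs0 : {n : ℕ} → BoolFun n → ℕ → Set
IsBs0 f k =
  (∃ λ x → f x ≡ false × SensBlocks f x k) ×
  (∀ x m → f x ≡ false → SensBlocks f x m → m ≤ k)

-- A term: AND of literals; pos = A_i (unnegated), neg = Ā_i (negated),
-- no variable occurs both unnegated and negated.
record Term (n : ℕ) : Set where
  field
    pos  : Subset n
    neg  : Subset n
    disj : Empty (pos ∩ neg)
open Term public

satTerm : {n : ℕ} → Term n → Input n → Bool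
satTerm {n} t x =
  and (map (λ i → (not (lookup (pos t) i) ∨ lookup x i)
                ∧ (not (lookup (neg t) i) ∨ not (lookup x i))) (allFin n))

evalDNF : {n d : ℕ} → (Fin d → Term n) → BoolFun n
evalDNF {n} {d} T x = or (map (λ i → satTerm (T i) x) (allFin d))

width : {n d : ℕ} → (Fin d → Term n) → ℕ
width {n} {d} T = foldr _⊔_ 0 (map (λ i → ∣ pos (T i) ∣ + ∣ neg (T i) ∣) (allFin d))

record Compact {n d : ℕ} (T : Fin d → Term n) : Set where
  field
    condA : evalDNF T (zeroInput n) ≡ false
    condB : ∃ λ k → IsBs0 (evalDNF T) k × IsBsAt (evalDNF T) (zeroInput n) k
    condC : ∀ i → ∃ λ x → satTerm (T i) x ≡ true ×
                           (∀ j → j ≢ i → satTerm (T j) x ≡ false)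

BlockProperty : {n d : ℕ} → (Fin d → Term n) → Set
BlockProperty T = ∀ i j → i ≢ j → Empty (pos (T i) ∩ pos (T j))

ceilDiv : (a b : ℕ) → .{{_ : NonZero b}} → ℕ
ceilDiv a b = (a + (b ∸ 1)) / b

-- For every term pick a representative variable k_i ∈ A_i (one exists because f(0) = 0).
-- Call terms i and j in conflict when Ā_i meets A_j. Since the A_j are disjoint, a term
-- conflicts with at most |Ā_i| ≤ d_∧ - 1 others, so the conflict graph has average degree
-- at most 2(d_∧ - 1) and greedily contains a conflict-free set I of ⌈d_∨ / (2d_∧ - 1)⌉ terms.
-- Let x set exactly the variables of A_i ∖ {k_i}, i ∈ I. Every term is falsified at its own
-- representative, so f(x) = 0, while flipping k_i satisfies term i: its positive literals
-- are set and, I being conflict-free, none of its negated variables is. Hence s(f, x) ≥ |I|.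
module Submission where

open import Defs
open import Data.Bool using (Bool; true; false; not; _∧_; _∨_; _xor_; if_then_else_)
import Data.Bool.Properties as Bool
open import Data.Bool.ListAction using (all; any)
open import Data.Empty using (⊥; ⊥-elim)
open import Data.Fin using (Fin; zero; suc; _≟_)
open import Data.Fin.Properties using (any?; suc-injective)
open import Data.Fin.Subset using (Subset; ∣_∣)
open import Data.Fin.Subset.Properties using (x∈p∩q⁺)
open import Data.List as List using ([]; _∷_; map; foldr; allFin)
open import Data.List.Membership.Propositional using (_∈_)
open import Data.List.Membership.Propositional.Properties using (∈-map⁺; ∈-concatMap⁺; ∈-allFin)
open import Data.List.Properties using (map-tabulate)
open import Data.List.Relation.Unary.Any as Any using (here; there)
open import Data.Nat using (ℕ; zero; suc; _+_; _*_; _∸_; _⊔_; _≤_; _<_; z≤n; s≤s; NonZero; >-nonZero⁻¹; _<?_; _≤?_)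
open import Data.Nat.DivMod using (m<n*o⇒m/o<n)
open import Data.Nat.ListAction using (sum)
open import Data.Nat.Properties hiding (_≟_; suc-injective)
open import Data.Nat.Tactic.RingSolver using (solve-∀)
open import Algebra.Properties.Semiring.Sum +-*-semiring
  using (sum-syntax; sum-cong-≗; ∑-comm; ∑-distrib-+; *-distribˡ-sum; *-distribʳ-sum; sum-replicate-zero)
open import Data.Product using (∃; _×_; _,_; proj₁; proj₂)
open import Data.Vec as Vec using ([]; _∷_; lookup)
open import Data.Vec.Properties using (lookup∘tabulate; lookup-replicate; lookup∘updateAt; lookup∘updateAt′; lookup⇒[]=)
open import Function using (_∘_; id)
open import Function.Definitions using (Injective)
open import Relation.Binary.PropositionalEquality
open import Relation.Nullary using (yes; no; does; contradiction)
open import Relation.Nullary.Decidable using (_×-dec_; dec-false)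

𝟙 : Bool → ℕ
𝟙 b = if b then 1 else 0

count : ∀ {n} → (Fin n → Bool) → ℕ
count {n} R = ∑[ i < n ] 𝟙 (R i)

𝟙*≤ : ∀ b m → 𝟙 b * m ≤ m
𝟙*≤ true  m = ≤-reflexive (+-identityʳ m)
𝟙*≤ false m = z≤n

𝟙≤1 : ∀ b → 𝟙 b ≤ 1
𝟙≤1 true  = s≤s z≤n
𝟙≤1 false = z≤n

∑-mono-≤ : ∀ {n} {f g : Fin n → ℕ} → (∀ i → f i ≤ g i) → ∑[ i < n ] f i ≤ ∑[ i < n ] g i
∑-mono-≤ {zero}  f≤g = z≤n
∑-mono-≤ {suc n} f≤g = +-mono-≤ (f≤g zero) (∑-mono-≤ (f≤g ∘ suc))

term≤∑ : ∀ {n} (f : Fin n → ℕ) i → f i ≤ ∑[ j < n ] f j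
term≤∑ f zero    = m≤m+n _ _
term≤∑ f (suc i) = ≤-trans (term≤∑ (f ∘ suc) i) (m≤n+m _ _)

count-positive : ∀ {n} (R : Fin n → Bool) {i} → R i ≡ true → 0 < count R
count-positive R {i} Ri = ≤-trans (≤-reflexive (cong 𝟙 (sym Ri))) (term≤∑ (𝟙 ∘ R) i)

count-full : ∀ n → count {n} (λ _ → true) ≡ n
count-full zero    = refl
count-full (suc n) = cong suc (count-full n)

⁅_⁆ : ∀ {n} → Fin n → Fin n → Bool
⁅ i ⁆ j = does (i ≟ j)

count-singleton : ∀ {n} (i : Fin n) → count ⁅ i ⁆ ≡ 1
count-singleton {suc n} zero    = cong suc (sum-replicate-zero n)
count-singleton {suc n} (suc i) = count-singleton i

∑-𝟙+singleton : ∀ {n} (R : Fin n → Bool) i → ∑[ j < n ] (𝟙 (R j) + 𝟙 (⁅ i ⁆ j)) ≡ count R + 1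
∑-𝟙+singleton R i = trans (∑-distrib-+ (𝟙 ∘ R) (𝟙 ∘ ⁅ i ⁆)) (cong (count R +_) (count-singleton i))

count-∧-singleton : ∀ {n} b (i : Fin n) → count (λ j → b ∧ ⁅ i ⁆ j) ≡ 𝟙 b
count-∧-singleton         true  i = count-singleton i
count-∧-singleton {n = n} false i = sum-replicate-zero n

∧-singleton⇒≡ : ∀ {n} b {i j : Fin n} → b ∧ ⁅ i ⁆ j ≡ true → i ≡ j
∧-singleton⇒≡ true {i} {j} p with i ≟ j
... | yes i≡j = i≡j

AtMostOne : ∀ {n} → (Fin n → Bool) → Set
AtMostOne R = ∀ i j → R i ≡ true → R j ≡ true → i ≡ j

atMostOne-tail : ∀ {n} {R : Fin (suc n) → Bool} → AtMostOne R → AtMostOne (R ∘ suc)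
atMostOne-tail unique i j p q = suc-injective (unique (suc i) (suc j) p q)

count≤𝟙 : ∀ {n} (R : Fin n → Bool) b → AtMostOne R → (∀ i → R i ≡ true → b ≡ true) → count R ≤ 𝟙 b
count≤𝟙 {zero}  R b unique R⇒b = z≤n
count≤𝟙 {suc n} R b unique R⇒b with R zero in R₀
... | false = count≤𝟙 (R ∘ suc) b (atMostOne-tail unique) (R⇒b ∘ suc)
... | true rewrite R⇒b zero R₀ = s≤s (count≤𝟙 (R ∘ suc) false (atMostOne-tail unique) tail-false)
  where
  tail-false : ∀ i → R (suc i) ≡ true → false ≡ true
  tail-false i p with unique zero (suc i) R₀ p
  ... | ()

∑-count-disjoint≤count : ∀ {m n} (Q : Fin m → Fin n → Bool) (S : Fin n → Bool) →
                         (∀ v → AtMostOne (λ i → Q i v)) →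
                         (∀ i v → Q i v ≡ true → S v ≡ true) →
                         ∑[ i < m ] count (Q i) ≤ count S
∑-count-disjoint≤count {m} {n} Q S disjoint Q⊆S = begin
  ∑[ i < m ] ∑[ v < n ] 𝟙 (Q i v)  ≡⟨ ∑-comm (λ i v → 𝟙 (Q i v)) ⟩
  ∑[ v < n ] ∑[ i < m ] 𝟙 (Q i v)  ≤⟨ ∑-mono-≤ (λ v → count≤𝟙 (λ i → Q i v) (S v) (disjoint v) (λ i → Q⊆S i v)) ⟩
  count S                          ∎
  where open ≤-Reasoning

count-mono-injective : ∀ {m n} (R : Fin m → Bool) (S : Fin n → Bool) (g : Fin m → Fin n) →
                       Injective _≡_ _≡_ g → (∀ i → R i ≡ true → S (g i) ≡ true) →
                       count R ≤ count S
count-mono-injective {m} R S g g-inj R⇒S = begin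
  count R                                         ≡⟨ sum-cong-≗ (λ i → count-∧-singleton (R i) (g i)) ⟨
  ∑[ i < m ] count (λ v → R i ∧ ⁅ g i ⁆ v)       ≤⟨ ∑-count-disjoint≤count _ S disjoint image ⟩
  count S                                         ∎
  where
  open ≤-Reasoning
  disjoint : ∀ v → AtMostOne (λ i → R i ∧ ⁅ g i ⁆ v)
  disjoint v i j p q = g-inj (trans (∧-singleton⇒≡ (R i) p) (sym (∧-singleton⇒≡ (R j) q)))
  image : ∀ i v → R i ∧ ⁅ g i ⁆ v ≡ true → S v ≡ true
  image i v p = subst (λ u → S u ≡ true) (∧-singleton⇒≡ (R i) p) (R⇒S i (Bool.∧-conicalˡ _ _ p))

exists-≤-average : ∀ {n} (R : Fin n → Bool) (D : Fin n → ℕ) {c} →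
                   ∑[ i < n ] (𝟙 (R i) * D i) ≤ count R * c → 0 < count R →
                   ∃ λ i → R i ≡ true × D i ≤ c
exists-≤-average {n} R D {c} ∑≤ R≢∅ with any? (λ i → R i Bool.≟ true ×-dec D i ≤? c)
... | yes found = found
... | no none   = contradiction ∑≤ (<⇒≱ (begin-strict
  count R * c                   <⟨ m<n+m _ R≢∅ ⟩
  count R + count R * c         ≡⟨ *-suc (count R) c ⟨
  count R * suc c               ≡⟨ *-distribʳ-sum (suc c) (𝟙 ∘ R) ⟩
  ∑[ i < n ] (𝟙 (R i) * suc c)  ≤⟨ ∑-mono-≤ above ⟩
  ∑[ i < n ] (𝟙 (R i) * D i)    ∎))
  where
  open ≤-Reasoning
  above : ∀ i → 𝟙 (R i) * suc c ≤ 𝟙 (R i) * D i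
  above i with R i in Ri
  ... | false = z≤n
  ... | true  = *-monoʳ-≤ 1 (≰⇒> λ D≤c → none (i , Ri , D≤c))

infix 4 _⊆_

_⊆_ : ∀ {n} → (Fin n → Bool) → (Fin n → Bool) → Set
R ⊆ S = ∀ i → R i ≡ true → S i ≡ true

Independent : ∀ {d} → (Fin d → Fin d → ℕ) → (Fin d → Bool) → Set
Independent e I = ∀ i j → I i ≡ true → I j ≡ true → i ≢ j → e i j ≡ 0

module GreedyIndependentSet {d : ℕ} (e : Fin d → Fin d → ℕ) (c : ℕ)
                            (∑-row≤ : ∀ i → ∑[ j < d ] e i j ≤ c) where

  weight : Fin d → Fin d → ℕ
  weight i j = e i j + e j i

  degreeIn : (Fin d → Bool) → Fin d → ℕ
  degreeIn R i = ∑[ j < d ] (𝟙 (R j) * weight i j)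

  ∑-degreeIn≤ : ∀ R → ∑[ i < d ] (𝟙 (R i) * degreeIn R i) ≤ count R * (c + c)
  ∑-degreeIn≤ R = begin
    ∑[ i < d ] (𝟙 (R i) * degreeIn R i)
      ≡⟨ sum-cong-≗ (λ i → trans (*-distribˡ-sum (𝟙 (R i)) (λ j → 𝟙 (R j) * weight i j))
                                 (sum-cong-≗ (λ j → split i j))) ⟩
    ∑[ i < d ] ∑[ j < d ] (inside i j + inside j i)
      ≡⟨ trans (sum-cong-≗ (λ i → ∑-distrib-+ (inside i) (λ j → inside j i)))
               (∑-distrib-+ (λ i → ∑[ j < d ] inside i j) (λ i → ∑[ j < d ] inside j i)) ⟩
    ∑[ i < d ] ∑[ j < d ] inside i j + ∑[ i < d ] ∑[ j < d ] inside j i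
      ≡⟨ cong (∑[ i < d ] ∑[ j < d ] inside i j +_) (∑-comm (λ i j → inside j i)) ⟩
    ∑[ i < d ] ∑[ j < d ] inside i j + ∑[ i < d ] ∑[ j < d ] inside i j
      ≤⟨ +-mono-≤ total≤ total≤ ⟩
    count R * c + count R * c
      ≡⟨ *-distribˡ-+ (count R) c c ⟨
    count R * (c + c) ∎
    where
    open ≤-Reasoning
    inside : Fin d → Fin d → ℕ
    inside i j = 𝟙 (R i) * (𝟙 (R j) * e i j)
    split : ∀ i j → 𝟙 (R i) * (𝟙 (R j) * weight i j) ≡ inside i j + inside j i
    split i j = distribute (𝟙 (R i)) (𝟙 (R j)) (e i j) (e j i)
      where
      distribute : ∀ a b x y → a * (b * (x + y)) ≡ a * (b * x) + b * (a * y)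
      distribute = solve-∀
    row≤ : ∀ i → ∑[ j < d ] inside i j ≤ 𝟙 (R i) * c
    row≤ i = begin
      ∑[ j < d ] inside i j                   ≡⟨ *-distribˡ-sum (𝟙 (R i)) (λ j → 𝟙 (R j) * e i j) ⟨
      𝟙 (R i) * ∑[ j < d ] (𝟙 (R j) * e i j) ≤⟨ *-monoʳ-≤ (𝟙 (R i)) (∑-mono-≤ (λ j → 𝟙*≤ (R j) (e i j))) ⟩
      𝟙 (R i) * ∑[ j < d ] e i j              ≤⟨ *-monoʳ-≤ (𝟙 (R i)) (∑-row≤ i) ⟩
      𝟙 (R i) * c                             ∎
    total≤ : ∑[ i < d ] ∑[ j < d ] inside i j ≤ count R * c
    total≤ = begin
      ∑[ i < d ] ∑[ j < d ] inside i j ≤⟨ ∑-mono-≤ row≤ ⟩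
      ∑[ i < d ] (𝟙 (R i) * c)         ≡⟨ *-distribʳ-sum c (𝟙 ∘ R) ⟨
      count R * c                      ∎

  lowDegreeVertex : ∀ R → 0 < count R → ∃ λ i → R i ≡ true × degreeIn R i ≤ c + c
  lowDegreeVertex R R≢∅ = exists-≤-average R (degreeIn R) (∑-degreeIn≤ R) R≢∅

  infixl 10 _∖N[_]

  -- R with i and all its neighbours in the symmetrised graph `weight` removed
  _∖N[_] : (Fin d → Bool) → Fin d → Fin d → Bool
  (R ∖N[ i ]) j with i ≟ j | weight i j
  ... | yes _ | _     = false
  ... | no _  | zero  = R j
  ... | no _  | suc _ = false

  ∖N-member : ∀ R i j → (R ∖N[ i ]) j ≡ true → R j ≡ true × i ≢ j × weight i j ≡ 0
  ∖N-member R i j p with i ≟ j | weight i j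
  ... | no i≢j | zero = p , i≢j , refl

  count-∖N< : ∀ R i → R i ≡ true → count (R ∖N[ i ]) < count R
  count-∖N< R i Ri = begin
    suc (count (R ∖N[ i ]))                          ≡⟨ +-comm 1 _ ⟩
    count (R ∖N[ i ]) + 1                            ≡⟨ ∑-𝟙+singleton (R ∖N[ i ]) i ⟨
    ∑[ j < d ] (𝟙 ((R ∖N[ i ]) j) + 𝟙 (⁅ i ⁆ j))  ≤⟨ ∑-mono-≤ pointwise ⟩
    count R                                          ∎
    where
    open ≤-Reasoning
    pointwise : ∀ j → 𝟙 ((R ∖N[ i ]) j) + 𝟙 (⁅ i ⁆ j) ≤ 𝟙 (R j)
    pointwise j with i ≟ j | weight i j
    ... | yes refl | _     = ≤-reflexive (cong 𝟙 (sym Ri))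
    ... | no _     | zero  = ≤-reflexive (+-identityʳ _)
    ... | no _     | suc _ = z≤n

  count≤count-∖N : ∀ R i → count R ≤ count (R ∖N[ i ]) + 1 + degreeIn R i
  count≤count-∖N R i = begin
    count R
      ≤⟨ ∑-mono-≤ pointwise ⟩
    ∑[ j < d ] (𝟙 ((R ∖N[ i ]) j) + 𝟙 (⁅ i ⁆ j) + 𝟙 (R j) * weight i j)
      ≡⟨ ∑-distrib-+ (λ j → 𝟙 ((R ∖N[ i ]) j) + 𝟙 (⁅ i ⁆ j)) (λ j → 𝟙 (R j) * weight i j) ⟩
    ∑[ j < d ] (𝟙 ((R ∖N[ i ]) j) + 𝟙 (⁅ i ⁆ j)) + degreeIn R i
      ≡⟨ cong (_+ degreeIn R i) (∑-𝟙+singleton (R ∖N[ i ]) i) ⟩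
    count (R ∖N[ i ]) + 1 + degreeIn R i ∎
    where
    open ≤-Reasoning
    pointwise : ∀ j → 𝟙 (R j) ≤ 𝟙 ((R ∖N[ i ]) j) + 𝟙 (⁅ i ⁆ j) + 𝟙 (R j) * weight i j
    pointwise j with i ≟ j | weight i j
    ... | yes _ | _     = ≤-trans (𝟙≤1 (R j)) (m≤m+n 1 _)
    ... | no _  | zero  = ≤-trans (m≤m+n _ 0) (m≤m+n _ _)
    ... | no _  | suc w = m≤m*n (𝟙 (R j)) (suc w)

  insert : Fin d → (Fin d → Bool) → Fin d → Bool
  insert i I j = ⁅ i ⁆ j ∨ I j

  count-insert : ∀ i I → I i ≡ false → count (insert i I) ≡ count I + 1
  count-insert i I Ii = trans (sum-cong-≗ pointwise) (∑-𝟙+singleton I i)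
    where
    pointwise : ∀ j → 𝟙 (insert i I j) ≡ 𝟙 (I j) + 𝟙 (⁅ i ⁆ j)
    pointwise j with i ≟ j
    ... | yes refl rewrite Ii = refl
    ... | no _     = sym (+-identityʳ _)

  insert-⊆ : ∀ R i I → R i ≡ true → I ⊆ R ∖N[ i ] → insert i I ⊆ R
  insert-⊆ R i I Ri I⊆ j j∈ with i ≟ j
  ... | yes refl = Ri
  ... | no _     = proj₁ (∖N-member R i j (I⊆ j j∈))

  insert-independent : ∀ R i I → I ⊆ R ∖N[ i ] → Independent e I → Independent e (insert i I)
  insert-independent R i I I⊆ indep a b a∈ b∈ a≢b with i ≟ a | i ≟ b
  ... | yes refl | yes refl = contradiction refl a≢b
  ... | yes refl | no _     = m+n≡0⇒m≡0 (e i b) (proj₂ (proj₂ (∖N-member R i b (I⊆ b b∈))))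
  ... | no _     | yes refl = m+n≡0⇒n≡0 (e i a) (proj₂ (proj₂ (∖N-member R i a (I⊆ a a∈))))
  ... | no _     | no _     = indep a b a∈ b∈ a≢b

  LargeIndependentSubset : (Fin d → Bool) → Set
  LargeIndependentSubset R = ∃ λ I → I ⊆ R × Independent e I × count R ≤ suc (c + c) * count I

  empty-large : ∀ R → count R ≡ 0 → LargeIndependentSubset R
  empty-large R R≡0 = (λ _ → false) , (λ _ ()) , (λ _ _ ()) , ≤-trans (≤-reflexive R≡0) z≤n

  extend-large : ∀ R i → R i ≡ true → degreeIn R i ≤ c + c →
                 LargeIndependentSubset (R ∖N[ i ]) → LargeIndependentSubset R
  extend-large R i Ri deg≤ (I , I⊆ , indep , large) =
    insert i I , insert-⊆ R i I Ri I⊆ , insert-independent R i I I⊆ indep , (begin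
      count R                                     ≤⟨ count≤count-∖N R i ⟩
      count (R ∖N[ i ]) + 1 + degreeIn R i        ≤⟨ +-mono-≤ (+-monoˡ-≤ 1 large) deg≤ ⟩
      suc (c + c) * count I + 1 + (c + c)         ≡⟨ regroup (c + c) (count I) ⟩
      suc (c + c) * (count I + 1)                 ≡⟨ cong (suc (c + c) *_) (count-insert i I i∉I) ⟨
      suc (c + c) * count (insert i I)            ∎)
    where
    open ≤-Reasoning
    regroup : ∀ a m → suc a * m + 1 + a ≡ suc a * (m + 1)
    regroup = solve-∀
    i∉I : I i ≡ false
    i∉I = Bool.¬-not λ Ii → proj₁ (proj₂ (∖N-member R i i (I⊆ i Ii))) refl

  greedy : ∀ m R → count R ≤ m → LargeIndependentSubset R
  greedy zero    R R≤0 = empty-large R (n≤0⇒n≡0 R≤0)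
  greedy (suc m) R R≤m with 0 <? count R
  ... | no  R≯0 = empty-large R (n≤0⇒n≡0 (≮⇒≥ R≯0))
  ... | yes R≢∅ with lowDegreeVertex R R≢∅
  ...   | i , Ri , deg≤ = extend-large R i Ri deg≤
                            (greedy m (R ∖N[ i ]) (≤-pred (≤-trans (count-∖N< R i Ri) R≤m)))

  independentSet : ∃ λ I → Independent e I × d ≤ suc (c + c) * count I
  independentSet with greedy d (λ _ → true) (≤-reflexive (count-full d))
  ... | I , _ , indep , large = I , indep , subst (_≤ suc (c + c) * count I) (count-full d) large

module _ {a} {A : Set a} (p : A → Bool) where

  all-true : ∀ xs → (∀ x → p x ≡ true) → all p xs ≡ true
  all-true []       _ = refl
  all-true (x ∷ xs) h rewrite h x = all-true xs h

  all-false : ∀ {x} xs → x ∈ xs → p x ≡ false → all p xs ≡ false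
  all-false (y ∷ ys) (here refl) px rewrite px = refl
  all-false (y ∷ ys) (there x∈) px with p y
  ... | true  = all-false ys x∈ px
  ... | false = refl

  any-true : ∀ {x} xs → x ∈ xs → p x ≡ true → any p xs ≡ true
  any-true (y ∷ ys) (here refl) px rewrite px = refl
  any-true (y ∷ ys) (there x∈) px with p y
  ... | true  = refl
  ... | false = any-true ys x∈ px

  any-false : ∀ xs → (∀ x → p x ≡ false) → any p xs ≡ false
  any-false []       _ = refl
  any-false (x ∷ xs) h rewrite h x = any-false xs h

foldr-⊔-∈ : ∀ {m} xs → m ∈ xs → m ≤ foldr _⊔_ 0 xs
foldr-⊔-∈ (x ∷ xs) (here refl) = m≤m⊔n x _
foldr-⊔-∈ (x ∷ xs) (there m∈) = ≤-trans (foldr-⊔-∈ xs m∈) (m≤n⊔m x _)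

sum-map-allFin : ∀ {n} (g : Fin n → ℕ) → sum (map g (allFin n)) ≡ ∑[ i < n ] g i
sum-map-allFin g = trans (cong sum (map-tabulate id g)) (sum-tabulate g)
  where
  sum-tabulate : ∀ {n} (g : Fin n → ℕ) → sum (List.tabulate g) ≡ ∑[ i < n ] g i
  sum-tabulate {zero}  g = refl
  sum-tabulate {suc n} g = cong (g zero +_) (sum-tabulate (g ∘ suc))

∣∣≡count : ∀ {n} (S : Subset n) → ∣ S ∣ ≡ count (lookup S)
∣∣≡count []          = refl
∣∣≡count (true  ∷ S) = cong suc (∣∣≡count S)
∣∣≡count (false ∷ S) = ∣∣≡count S

∈-allInputs : ∀ {n} (x : Input n) → x ∈ allInputs n
∈-allInputs []          = here refl
∈-allInputs (false ∷ x) =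
  ∈-concatMap⁺ (λ v → (false ∷ v) ∷ (true ∷ v) ∷ []) (Any.map (λ { refl → here refl }) (∈-allInputs x))
∈-allInputs (true  ∷ x) =
  ∈-concatMap⁺ (λ v → (false ∷ v) ∷ (true ∷ v) ∷ []) (Any.map (λ { refl → there (here refl) }) (∈-allInputs x))

sensAt≤sens : ∀ {n} (f : BoolFun n) x → sensAt f x ≤ sens f
sensAt≤sens f x = foldr-⊔-∈ _ (∈-map⁺ (sensAt f) (∈-allInputs x))

size≤width : ∀ {n d} (T : Fin d → Term n) i → ∣ pos (T i) ∣ + ∣ neg (T i) ∣ ≤ width T
size≤width T i = foldr-⊔-∈ _ (∈-map⁺ (λ j → ∣ pos (T j) ∣ + ∣ neg (T j) ∣) (∈-allFin i))

ceilDiv≤ : ∀ b .{{_ : NonZero b}} a m → a ≤ b * m → ceilDiv a b ≤ m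
ceilDiv≤ b a m a≤bm = ≤-pred (m<n*o⇒m/o<n (begin-strict
  a + (b ∸ 1)     ≤⟨ +-monoˡ-≤ (b ∸ 1) (≤-trans a≤bm (≤-reflexive (*-comm b m))) ⟩
  m * b + (b ∸ 1) <⟨ +-monoʳ-< (m * b) (∸-monoʳ-< {o = 0} (s≤s z≤n) (>-nonZero⁻¹ b)) ⟩
  m * b + b       ≡⟨ +-comm (m * b) b ⟩
  suc m * b       ∎))
  where open ≤-Reasoning

literal-true : ∀ p q b → (p ≡ true → b ≡ true) → (q ≡ true → b ≡ false) →
               (not p ∨ b) ∧ (not q ∨ not b) ≡ true
literal-true false false b     _  _  = refl
literal-true false true  false _  _  = refl
literal-true false true  true  _  q⇒ = contradiction (q⇒ refl) λ ()
literal-true true  false true  _  _  = refl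
literal-true true  true  true  _  q⇒ = contradiction (q⇒ refl) λ ()
literal-true true  q     false p⇒ _  = contradiction (p⇒ refl) λ ()

module _ {n : ℕ} (t : Term n) (x : Input n) where

  satTerm-true : (∀ v → (lookup (pos t) v ≡ true → lookup x v ≡ true) ×
                        (lookup (neg t) v ≡ true → lookup x v ≡ false)) →
                 satTerm t x ≡ true
  satTerm-true h = all-true _ (allFin n) λ v → literal-true _ _ _ (proj₁ (h v)) (proj₂ (h v))

  satTerm-false : ∀ v → lookup (pos t) v ≡ true → lookup x v ≡ false → satTerm t x ≡ false
  satTerm-false v p q = all-false _ (allFin n) (∈-allFin v) literal-false
    where
    literal-false : (not (lookup (pos t) v) ∨ lookup x v) ∧
                    (not (lookup (neg t) v) ∨ not (lookup x v)) ≡ false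
    literal-false rewrite p | q = refl

module _ {n d : ℕ} (T : Fin d → Term n) where

  evalDNF-true : ∀ x i → satTerm (T i) x ≡ true → evalDNF T x ≡ true
  evalDNF-true x i = any-true _ (allFin d) (∈-allFin i)

  evalDNF-false : ∀ x → (∀ i → satTerm (T i) x ≡ false) → evalDNF T x ≡ false
  evalDNF-false x = any-false _ (allFin d)

  pos-nonempty : evalDNF T (zeroInput n) ≡ false → ∀ i → ∃ λ v → lookup (pos (T i)) v ≡ true
  pos-nonempty f0≡0 i with any? (λ v → lookup (pos (T i)) v Bool.≟ true)
  ... | yes found = found
  ... | no none   = contradiction (trans (sym f0≡1) f0≡0) λ ()
    where
    f0≡1 : evalDNF T (zeroInput n) ≡ true
    f0≡1 = evalDNF-true (zeroInput n) i (satTerm-true (T i) (zeroInput n) λ v →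
             (λ p → contradiction (v , p) none) , (λ _ → lookup-replicate v false))

module Witness {n d : ℕ} (T : Fin d → Term n) (blk : BlockProperty T)
               (f0≡0 : evalDNF T (zeroInput n) ≡ false) where

  P N : Fin d → Fin n → Bool
  P i = lookup (pos (T i))
  N i = lookup (neg (T i))

  pos-unique : ∀ {i j v} → P i v ≡ true → P j v ≡ true → i ≡ j
  pos-unique {i} {j} {v} p q with i ≟ j
  ... | yes i≡j = i≡j
  ... | no i≢j  = ⊥-elim (blk i j i≢j (v , x∈p∩q⁺ (lookup⇒[]= v _ p , lookup⇒[]= v _ q)))

  pos-neg-disjoint : ∀ {i v} → P i v ≡ true → N i v ≡ true → ⊥
  pos-neg-disjoint {i} {v} p q = disj (T i) (v , x∈p∩q⁺ (lookup⇒[]= v _ p , lookup⇒[]= v _ q))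

  conflicts : Fin d → Fin d → ℕ
  conflicts i j = count (λ v → N i v ∧ P j v)

  ∑-conflicts≤∣neg∣ : ∀ i → ∑[ j < d ] conflicts i j ≤ ∣ neg (T i) ∣
  ∑-conflicts≤∣neg∣ i = begin
    ∑[ j < d ] conflicts i j ≤⟨ ∑-count-disjoint≤count (λ j v → N i v ∧ P j v) (N i) disjoint inNeg ⟩
    count (N i)              ≡⟨ ∣∣≡count (neg (T i)) ⟨
    ∣ neg (T i) ∣            ∎
    where
    open ≤-Reasoning
    disjoint : ∀ v → AtMostOne (λ j → N i v ∧ P j v)
    disjoint v j j′ p q = pos-unique (Bool.∧-conicalʳ _ _ p) (Bool.∧-conicalʳ _ _ q)
    inNeg : ∀ j v → N i v ∧ P j v ≡ true → N i v ≡ true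
    inNeg j v = Bool.∧-conicalˡ _ _

  k : Fin d → Fin n
  k i = proj₁ (pos-nonempty T f0≡0 i)

  k∈pos : ∀ i → P i (k i) ≡ true
  k∈pos i = proj₂ (pos-nonempty T f0≡0 i)

  k-injective : Injective _≡_ _≡_ k
  k-injective {i} {j} ki≡kj = pos-unique (k∈pos i) (subst (λ v → P j v ≡ true) (sym ki≡kj) (k∈pos j))

  ∑-conflicts≤ : ∀ i → ∑[ j < d ] conflicts i j ≤ width T ∸ 1
  ∑-conflicts≤ i = ≤-trans (∑-conflicts≤∣neg∣ i) (∸-monoˡ-≤ 1 (begin
    suc ∣ neg (T i) ∣             ≤⟨ +-monoˡ-≤ ∣ neg (T i) ∣ pos≢∅ ⟩
    ∣ pos (T i) ∣ + ∣ neg (T i) ∣ ≤⟨ size≤width T i ⟩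
    width T                       ∎))
    where
    open ≤-Reasoning
    pos≢∅ : 1 ≤ ∣ pos (T i) ∣
    pos≢∅ = subst (1 ≤_) (sym (∣∣≡count (pos (T i)))) (count-positive (P i) (k∈pos i))

  module _ (I : Fin d → Bool) (indep : Independent conflicts I) where

    covers : Fin n → Fin d → Bool
    covers v i = P i v ∧ (not (does (v ≟ k i)) ∧ I i)

    x : Input n
    x = Vec.tabulate λ v → any (covers v) (allFin d)

    no-conflict : ∀ {i i′ v} → I i ≡ true → I i′ ≡ true → N i v ≡ true → P i′ v ≡ true → ⊥
    no-conflict {i} {i′} {v} Ii Ii′ q p with i ≟ i′
    ... | yes refl = pos-neg-disjoint p q
    ... | no i≢i′  = <⇒≢ (count-positive (λ u → N i u ∧ P i′ u) (cong₂ _∧_ q p))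
                           (sym (indep i i′ Ii Ii′ i≢i′))

    x-rep : ∀ j → lookup x (k j) ≡ false
    x-rep j = trans (lookup∘tabulate _ (k j)) (any-false _ (allFin d) uncovered)
      where
      uncovered : ∀ i → covers (k j) i ≡ false
      uncovered i with P i (k j) in p | k j ≟ k i
      ... | false | _        = refl
      ... | true  | yes _    = refl
      ... | true  | no kj≢ki = contradiction (cong k (pos-unique (k∈pos j) p)) kj≢ki

    x-pos : ∀ {i v} → I i ≡ true → P i v ≡ true → v ≢ k i → lookup x v ≡ true
    x-pos {i} {v} Ii p v≢ki =
      trans (lookup∘tabulate _ v) (any-true _ (allFin d) (∈-allFin i) covered)
      where
      covered : covers v i ≡ true
      covered rewrite p | dec-false (v ≟ k i) v≢ki | Ii = refl

    x-neg : ∀ {i v} → I i ≡ true → N i v ≡ true → lookup x v ≡ false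
    x-neg {i} {v} Ii q = trans (lookup∘tabulate _ v) (any-false _ (allFin d) uncovered)
      where
      uncovered : ∀ i′ → covers v i′ ≡ false
      uncovered i′ with P i′ v in p | v ≟ k i′ | I i′ in Ii′
      ... | false | _     | _     = refl
      ... | true  | yes _ | _     = refl
      ... | true  | no _  | false = refl
      ... | true  | no _  | true  = ⊥-elim (no-conflict Ii Ii′ q p)

    evalDNF-x : evalDNF T x ≡ false
    evalDNF-x = evalDNF-false T x λ j → satTerm-false (T j) x (k j) (k∈pos j) (x-rep j)

    evalDNF-flip : ∀ i → I i ≡ true → evalDNF T (flipBit (k i) x) ≡ true
    evalDNF-flip i Ii =
      evalDNF-true T (flipBit (k i) x) i (satTerm-true (T i) (flipBit (k i) x) literal)
      where
      literal : ∀ v → (P i v ≡ true → lookup (flipBit (k i) x) v ≡ true) ×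
                      (N i v ≡ true → lookup (flipBit (k i) x) v ≡ false)
      literal v with v ≟ k i
      ... | yes refl = (λ _ → trans (lookup∘updateAt (k i) x) (cong not (x-rep i)))
                     , (λ q → ⊥-elim (pos-neg-disjoint (k∈pos i) q))
      ... | no v≢ki  = (λ p → trans (lookup∘updateAt′ v (k i) v≢ki x) (x-pos Ii p v≢ki))
                     , (λ q → trans (lookup∘updateAt′ v (k i) v≢ki x) (x-neg Ii q))

    count≤sensAt : count I ≤ sensAt (evalDNF T) x
    count≤sensAt = begin
      count I              ≤⟨ count-mono-injective I sensitive k k-injective rep-sensitive ⟩
      count sensitive      ≡⟨ sum-map-allFin (𝟙 ∘ sensitive) ⟨
      sensAt (evalDNF T) x ∎
      where
      open ≤-Reasoning
      sensitive : Fin n → Bool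
      sensitive v = evalDNF T x xor evalDNF T (flipBit v x)
      rep-sensitive : ∀ i → I i ≡ true → sensitive (k i) ≡ true
      rep-sensitive i Ii rewrite evalDNF-x | evalDNF-flip i Ii = refl

    count≤sens : count I ≤ sens (evalDNF T)
    count≤sens = ≤-trans count≤sensAt (sensAt≤sens (evalDNF T) x)

2*w∸1≡1+2*[w∸1] : ∀ w → 0 < 2 * w ∸ 1 → 2 * w ∸ 1 ≡ suc ((w ∸ 1) + (w ∸ 1))
2*w∸1≡1+2*[w∸1] (suc w) _ = reorder w
  where
  reorder : ∀ w → w + suc (w + 0) ≡ suc (w + w)
  reorder = solve-∀

lemma5 : (n d : ℕ) (T : Fin d → Term n) →
         Compact T → BlockProperty T →
         .{{_ : NonZero (2 * width T ∸ 1)}} →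
         ceilDiv d (2 * width T ∸ 1) ≤ sens (evalDNF T)
lemma5 n d T cmp blk = ceilDiv≤ (2 * width T ∸ 1) d (sens (evalDNF T)) (begin
  d                                     ≤⟨ d≤ ⟩
  suc (c + c) * count I                 ≤⟨ *-mono-≤ (≤-reflexive odd) (count≤sens I indep) ⟩
  (2 * width T ∸ 1) * sens (evalDNF T)  ∎)
  where
  open ≤-Reasoning
  open Witness T blk (Compact.condA cmp)
  c : ℕ
  c = width T ∸ 1
  open GreedyIndependentSet conflicts c ∑-conflicts≤ using (independentSet)
  I : Fin d → Bool
  I = proj₁ independentSet
  indep : Independent conflicts I
  indep = proj₁ (proj₂ independentSet)
  d≤ : d ≤ suc (c + c) * count I
  d≤ = proj₂ (proj₂ independentSet)
  odd : suc (c + c) ≡ 2 * width T ∸ 1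
  odd = sym (2*w∸1≡1+2*[w∸1] (width T) (>-nonZero⁻¹ _))
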